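{- For every positive integer $m$, the function $H_m:\mathbb{N}\to\{0,1\}$ is completely multiplicative, i.e. $H_m(xy)=H_m(x)H_m(y)$ for all positive integers $x,y$.
   Context: For $m,n\in\mathbb{N}$, the Schemmel totient function $L_m(n)$ is the number of integers $k\in\{1,\dots,n\}$ such that $\gcd(k+s,n)=1$ for all $s\in\{0,1,\dots,m-1\}$; by convention $L_m(0)=0$. Equivalently, $L_m(1)=1$, and for $n>1$ with canonical prime factorization $n=\prod_{i=1}^r p_i^{\alpha_i}$, $L_m(n)=0$ if the smallest prime factor of $n$ is $\le m$, and $L_m(n)=\prod_{i=1}^r p_i^{\alpha_i-1}(p_i-m)$ otherwise. For a function $f$, $f^{(1)}=f$ and $f^{(k+1)}=f\circ f^{(k)}$. For $m,n\in\mathbb{N}$, $R_m(n)$ is the least positive integer $k$ such that $L_m^{(k)}(n)\in\{0,1\}$, and $H_m(n)=L_m^{(R_m(n))}(n)\in\{0,1\}$. -}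

module Defs where

open import Data.Nat using (ℕ; zero; suc; _+_; _*_; _<_; _≤_)
open import Data.Nat.GCD using (gcd)
open import Data.List using (List; length; filter; upTo)
open import Data.List.Relation.Unary.All using (All; all?)
open import Relation.Nullary using (Dec)
open import Data.Nat.Properties using (_≟_)
open import Relation.Binary.PropositionalEquality using (_≡_)
open import Data.Sum using (_⊎_)
open import Data.Product using (_×_)
open import Relation.Nullary using (¬_)
open import Function using (_∘_)

Good : ℕ → ℕ → ℕ → Set
Good m n k = All (λ s → gcd (k + s) n ≡ 1) (upTo m)

good? : ∀ m n k → Dec (Good m n k)
good? m n k = all? (λ s → gcd (k + s) n ≟ 1) (upTo m)

-- Schemmel totient: L m n = #{ k ∈ {1,…,n} | ∀ s < m, gcd (k+s, n) = 1 }
-- (for n = 0 the range is empty, so L m 0 = 0 as per the convention)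
L : ℕ → ℕ → ℕ
L m n = length (filter (λ k → good? m n (suc k)) (upTo n))

iter : (ℕ → ℕ) → ℕ → ℕ → ℕ
iter f zero    n = n
iter f (suc k) n = f (iter f k n)

In01 : ℕ → Set
In01 v = v ≡ 0 ⊎ v ≡ 1

IsR : ℕ → ℕ → ℕ → Set
IsR m n k = 1 ≤ k × In01 (iter (L m) k n)
              × (∀ j → 1 ≤ j → j < k → ¬ In01 (iter (L m) j n))

IsH : ℕ → ℕ → ℕ → Set
IsH m n h = Data.Product.Σ ℕ (λ k → IsR m n k × iter (L m) k n ≡ h)

-- H_m(n) = 0 exactly when some iterate of L_m on n vanishes, so the theorem says that an
-- iterate of xy vanishes iff one of x, y has a vanishing iterate. Everything rests on
-- the recursion, for p prime,
--   L_m(p n) = p L_m(n) if p ∣ n,      L_m(p n) = L_m(p) L_m(n) = (p ∸ m) L_m(n) if p ∤ n,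
-- obtained by counting the k ≤ p n satisfying Good in p blocks of length n: Good for n is
-- n-periodic, and when p ∤ n the numbers i + j n (j < p) run through every residue mod p
-- once, p ∸ m of them Good for p.
-- By the recursion L_m, and hence each of its iterates, preserves divisibility: if x or y
-- reaches 0, so does xy. Conversely, each prime factor of L_m(n) divides n or L_m(p) for
-- a prime p ∣ n, so "n ≠ 0 and no prime factor of n reaches 0" passes from n to L_m(n);
-- it therefore keeps n from ever reaching 0, and it holds for xy when x, y never reach 0.
module Submission where

open import Defs
open import Data.Nat
open import Data.Nat.Properties
open import Data.Nat.Divisibility
open import Data.Nat.DivMod using (_%_; _/_; m≡m%n+[m/n]*n; m%n<n)
open import Data.Nat.GCD using (module Bézout)
open import Data.Nat.Coprimality using (Coprime; coprime⇒gcd≡1; gcd≡1⇒coprime; coprime-Bézout; coprime-divisor)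
open import Data.Nat.Primality using (Prime; prime⇒irreducible; prime⇒nonZero; ¬prime[1]; euclidsLemma)
open import Data.Nat.Primality.Factorisation using (factorise; PrimeFactorisation)
open import Data.Nat.ListAction using (product)
open import Data.Nat.Tactic.RingSolver using (solve-∀)
open import Data.List using (List; []; _∷_; applyUpTo; filter; length)
open import Data.List.Relation.Unary.All using (All; []; _∷_)
open import Data.List.Relation.Unary.All.Properties using (applyUpTo⁺₁; applyUpTo⁻)
open import Data.Product using (∃-syntax; _×_; _,_; proj₁; proj₂)
open import Data.Sum using (_⊎_; inj₁; inj₂; [_,_])
open import Function using (_∘_; id; _⇔_; mk⇔; Equivalence)
open import Relation.Nullary using (Dec; yes; no; ¬_; contradiction)
open import Relation.Unary using (Decidable)
open import Relation.Binary.PropositionalEquality hiding ([_])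
open import Algebra.Properties.CommutativeSemigroup +-commutativeSemigroup using (interchange; xy∙z≈xz∙y)

open Equivalence using (to; from)

private variable
  P Q R : Set
  a b c d j j′ m n p x : ℕ
  f g : ℕ → ℕ

𝟙 : Dec P → ℕ
𝟙 (yes _) = 1
𝟙 (no _)  = 0

𝟙-yes : P → (P? : Dec P) → 𝟙 P? ≡ 1
𝟙-yes p (yes _) = refl
𝟙-yes p (no ¬p) = contradiction p ¬p

𝟙-no : ¬ P → (P? : Dec P) → 𝟙 P? ≡ 0
𝟙-no ¬p (yes p) = contradiction p ¬p
𝟙-no ¬p (no _)  = refl

𝟙≡0⇒¬ : (P? : Dec P) → 𝟙 P? ≡ 0 → ¬ P
𝟙≡0⇒¬ (no ¬p) _ = ¬p

𝟙-cong : P ⇔ Q → (P? : Dec P) (Q? : Dec Q) → 𝟙 P? ≡ 𝟙 Q?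
𝟙-cong P⇔Q (yes p) Q? = sym (𝟙-yes (to P⇔Q p) Q?)
𝟙-cong P⇔Q (no ¬p) Q? = sym (𝟙-no (¬p ∘ from P⇔Q) Q?)

𝟙-× : R ⇔ (P × Q) → (R? : Dec R) (P? : Dec P) (Q? : Dec Q) → 𝟙 R? ≡ 𝟙 P? * 𝟙 Q?
𝟙-× R⇔P×Q R? (yes p) (yes q) = 𝟙-yes (from R⇔P×Q (p , q)) R?
𝟙-× R⇔P×Q R? (yes p) (no ¬q) = 𝟙-no (¬q ∘ proj₂ ∘ to R⇔P×Q) R?
𝟙-× R⇔P×Q R? (no ¬p) Q?      = 𝟙-no (¬p ∘ proj₁ ∘ to R⇔P×Q) R?

∑< : ℕ → (ℕ → ℕ) → ℕ
∑< zero    f = 0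
∑< (suc n) f = ∑< n f + f n

syntax ∑< n (λ k → e) = ∑[ k < n ] e

∑-cong : ∀ n → (∀ k → k < n → f k ≡ g k) → ∑< n f ≡ ∑< n g
∑-cong zero    eq = refl
∑-cong (suc n) eq = cong₂ _+_ (∑-cong n (λ k k<n → eq k (m<n⇒m<1+n k<n))) (eq n ≤-refl)

∑-const : ∀ n c → ∑[ _ < n ] c ≡ n * c
∑-const zero    c = refl
∑-const (suc n) c = trans (cong (_+ c) (∑-const n c)) (+-comm (n * c) c)

∑-zero : ∀ n → ∑[ _ < n ] 0 ≡ 0
∑-zero n = trans (∑-const n 0) (*-zeroʳ n)

∑-suc : ∀ n → ∑< (suc n) f ≡ f 0 + ∑< n (f ∘ suc)
∑-suc zero        = +-comm 0 _
∑-suc {f} (suc n) = trans (cong (_+ f (suc n)) (∑-suc n)) (+-assoc (f 0) _ _)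

∑-+ : ∀ n → ∑[ k < n ] (f k + g k) ≡ ∑< n f + ∑< n g
∑-+ zero = refl
∑-+ {f} {g} (suc n) = trans (cong (_+ (f n + g n)) (∑-+ n)) (interchange (∑< n f) (∑< n g) (f n) (g n))

∑-*ˡ : ∀ n c → ∑[ k < n ] (c * f k) ≡ c * ∑< n f
∑-*ˡ zero        c = sym (*-zeroʳ c)
∑-*ˡ {f} (suc n) c = trans (cong (_+ c * f n) (∑-*ˡ n c)) (sym (*-distribˡ-+ c (∑< n f) (f n)))

∑-*ʳ : ∀ n c → ∑[ k < n ] (f k * c) ≡ ∑< n f * c
∑-*ʳ {f} n c = trans (∑-cong n (λ k _ → *-comm (f k) c)) (trans (∑-*ˡ n c) (*-comm c (∑< n f)))

∑-+-range : ∀ a b → ∑< (a + b) f ≡ ∑< a f + ∑[ k < b ] f (a + k)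
∑-+-range a zero        = trans (cong (λ n → ∑< n _) (+-identityʳ a)) (sym (+-identityʳ _))
∑-+-range {f} a (suc b) = begin
  ∑< (a + suc b) f                          ≡⟨ cong (λ n → ∑< n f) (+-suc a b) ⟩
  ∑< (a + b) f + f (a + b)                  ≡⟨ cong (_+ f (a + b)) (∑-+-range a b) ⟩
  ∑< a f + ∑[ k < b ] f (a + k) + f (a + b) ≡⟨ +-assoc (∑< a f) _ _ ⟩
  ∑< a f + ∑[ k < suc b ] f (a + k)         ∎
  where open ≡-Reasoning

∑-blocks : ∀ a n → ∑< (a * n) f ≡ ∑[ j < a ] ∑[ i < n ] f (j * n + i)
∑-blocks zero    n = refl
∑-blocks {f} (suc a) n = begin
  ∑< (n + a * n) f                        ≡⟨ cong (λ N → ∑< N f) (+-comm n (a * n)) ⟩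
  ∑< (a * n + n) f                        ≡⟨ ∑-+-range (a * n) n ⟩
  ∑< (a * n) f + ∑[ i < n ] f (a * n + i) ≡⟨ cong (_+ ∑[ i < n ] f (a * n + i)) (∑-blocks a n) ⟩
  ∑[ j < suc a ] ∑[ i < n ] f (j * n + i) ∎
  where open ≡-Reasoning

∑-periodic : ∀ a n → (∀ j i → f (j * n + i) ≡ f i) → ∑< (a * n) f ≡ a * ∑< n f
∑-periodic {f} a n periodic = begin
  ∑< (a * n) f                        ≡⟨ ∑-blocks a n ⟩
  ∑[ j < a ] ∑[ i < n ] f (j * n + i) ≡⟨ ∑-cong a (λ j _ → ∑-cong n (λ i _ → periodic j i)) ⟩
  ∑[ _ < a ] ∑< n f                   ≡⟨ ∑-const a (∑< n f) ⟩
  a * ∑< n f                          ∎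
  where open ≡-Reasoning

∑-comm : ∀ a n (h : ℕ → ℕ → ℕ) → ∑[ j < a ] ∑[ i < n ] h j i ≡ ∑[ i < n ] ∑[ j < a ] h j i
∑-comm zero    n h = sym (∑-zero n)
∑-comm (suc a) n h = trans (cong (_+ ∑[ i < n ] h a i) (∑-comm a n h)) (sym (∑-+ n))

∑≡0⇒≡0 : ∀ n → ∑< n f ≡ 0 → ∀ k → k < n → f k ≡ 0
∑≡0⇒≡0 {f} (suc n) ∑≡0 k k<1+n with m<1+n⇒m<n∨m≡n k<1+n
... | inj₁ k<n  = ∑≡0⇒≡0 n (m+n≡0⇒m≡0 (∑< n f) ∑≡0) k k<n
... | inj₂ refl = m+n≡0⇒n≡0 (∑< n f) ∑≡0

term≤∑ : ∀ n → d < n → f d ≤ ∑< n f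
term≤∑ {d} {f} (suc n) d<1+n with m<1+n⇒m<n∨m≡n d<1+n
... | inj₁ d<n  = ≤-trans (term≤∑ n d<n) (m≤m+n (∑< n f) (f n))
... | inj₂ refl = m≤n+m (f d) (∑< d f)

length-filter-∷ : {A : ℕ → Set} (A? : Decidable A) (x : ℕ) (xs : List ℕ) →
  length (filter A? (x ∷ xs)) ≡ 𝟙 (A? x) + length (filter A? xs)
length-filter-∷ A? x xs with A? x
... | yes _ = refl
... | no _  = refl

length-filter-applyUpTo : {A : ℕ → Set} (A? : Decidable A) (f : ℕ → ℕ) (n : ℕ) →
  length (filter A? (applyUpTo f n)) ≡ ∑[ k < n ] 𝟙 (A? (f k))
length-filter-applyUpTo A? f zero    = refl
length-filter-applyUpTo A? f (suc n) =
  trans (length-filter-∷ A? (f 0) _)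
        (trans (cong (𝟙 (A? (f 0)) +_) (length-filter-applyUpTo A? (f ∘ suc) n)) (sym (∑-suc n)))

∑𝟙≤1 : ∀ {A : ℕ → Set} (A? : Decidable A) (n : ℕ) →
  (∀ {k k′} → k < n → k′ < n → A k → A k′ → k ≡ k′) → ∑[ k < n ] 𝟙 (A? k) ≤ 1
∑𝟙≤1 A? zero    unique = z≤n
∑𝟙≤1 {A} A? (suc n) unique with A? n
... | no _  = subst (_≤ 1) (sym (+-identityʳ _))
                    (∑𝟙≤1 A? n (λ k<n k′<n → unique (m<n⇒m<1+n k<n) (m<n⇒m<1+n k′<n)))
... | yes a = ≤-reflexive (cong (_+ 1) none-before)
  where
  none-before : ∑[ k < n ] 𝟙 (A? k) ≡ 0
  none-before = trans (∑-cong n (λ k k<n → 𝟙-no (¬A k<n) (A? k))) (∑-zero n)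
    where
    ¬A : ∀ {k} → k < n → ¬ A k
    ¬A k<n ak = <-irrefl (unique (m<n⇒m<1+n k<n) ≤-refl ak a) k<n

coprime-∣ʳ : d ∣ n → Coprime a n → Coprime a d
coprime-∣ʳ d∣n a⊥n (e∣a , e∣d) = a⊥n (e∣a , ∣-trans e∣d d∣n)

coprime-*ʳ : Coprime a b → Coprime a n → Coprime a (b * n)
coprime-*ʳ {a} {b} {n} a⊥b a⊥n {d} (d∣a , d∣bn) =
  a⊥b (d∣a , coprime-divisor d⊥n (subst (d ∣_) (*-comm b n) d∣bn))
  where
  d⊥n : Coprime d n
  d⊥n (e∣d , e∣n) = a⊥n (∣-trans e∣d d∣a , e∣n)

coprime-+-*ˡ : ∀ j → Coprime (x + j * n) n ⇔ Coprime x n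
coprime-+-*ˡ {x = x} {n = n} j = mk⇔
  (λ coprime {e} (e∣x , e∣n) → coprime (∣m∣n⇒∣m+n e∣x (∣n⇒∣m*n j e∣n) , e∣n))
  (λ coprime {e} (e∣x+jn , e∣n) →
     coprime (∣m+n∣m⇒∣n (subst (e ∣_) (+-comm x (j * n)) e∣x+jn) (∣n⇒∣m*n j e∣n) , e∣n))

coprime-prime⇔∤ : Prime p → Coprime a p ⇔ p ∤ a
coprime-prime⇔∤ {p} {a} pr = mk⇔
  (λ a⊥p p∣a → ¬prime[1] (subst Prime (a⊥p (p∣a , ∣-refl)) pr))
  (λ p∤a {d} (d∣a , d∣p) →
     [ id , (λ d≡p → contradiction (subst (_∣ a) d≡p d∣a) p∤a) ] (prime⇒irreducible pr d∣p))

prime∤1 : Prime p → p ∤ 1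
prime∤1 pr p∣1 = ¬prime[1] (subst Prime (∣1⇒≡1 p∣1) pr)

<∧∣⇒≡0 : d < p → p ∣ d → d ≡ 0
<∧∣⇒≡0 {zero}  _   _   = refl
<∧∣⇒≡0 {suc d} d<p p∣d = contradiction p∣d (>⇒∤ d<p)

∃-p∣1+a*n : Prime p → p ∤ n → ∃[ a ] p ∣ 1 + a * n
∃-p∣1+a*n {p} {n} pr p∤n with coprime-Bézout (from (coprime-prime⇔∤ pr) p∤n)
... | Bézout.-+ a b eq = a , divides b eq
-- Here b p + 1 = a n, so a (p ∸ 1) n ≡ p ∸ 1 ≡ -1 (mod p).
∃-p∣1+a*n {suc q} {n} pr p∤n | Bézout.+- a b eq = a * q , divides (1 + q * b) (begin
  1 + a * q * n           ≡⟨ cong suc (reorder a q n) ⟩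
  1 + q * (a * n)         ≡⟨ cong (λ t → 1 + q * t) (sym eq) ⟩
  1 + q * (1 + b * suc q) ≡⟨ factor q b ⟩
  (1 + q * b) * suc q     ∎)
  where
  open ≡-Reasoning
  reorder : ∀ a q n → a * q * n ≡ q * (a * n)
  reorder = solve-∀
  factor : ∀ q b → 1 + q * (1 + b * suc q) ≡ (1 + q * b) * suc q
  factor = solve-∀

∃-progression-multiple : Prime p → p ∤ n → ∀ c → ∃[ j ] j < p × p ∣ c + j * n
∃-progression-multiple {p} {n} pr p∤n c with ∃-p∣1+a*n pr p∤n
... | a , p∣1+an =
  a * c % p , m%n<n (a * c) p , reduce (a * c) (subst (p ∣_) (expand c a n) (∣n⇒∣m*n c p∣1+an))
  where
  instance
    p-nonZero : NonZero p
    p-nonZero = prime⇒nonZero pr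
  expand : ∀ c a n → c * (1 + a * n) ≡ c + a * c * n
  expand = solve-∀
  regroup : ∀ c r q p n → c + (r + q * p) * n ≡ q * p * n + (c + r * n)
  regroup = solve-∀
  reduce : ∀ J → p ∣ c + J * n → p ∣ c + J % p * n
  reduce J p∣c+Jn = ∣m+n∣m⇒∣n (subst (p ∣_) shift p∣c+Jn) (n∣m*n*o (J / p) n)
    where
    shift : c + J * n ≡ J / p * p * n + (c + J % p * n)
    shift = trans (cong (λ t → c + t * n) (m≡m%n+[m/n]*n J p)) (regroup c (J % p) (J / p) p n)

progression-multiple-unique-≤ : Prime p → p ∤ n → j ≤ j′ → j′ < p →
  p ∣ c + j * n → p ∣ c + j′ * n → j ≡ j′
progression-multiple-unique-≤ {p} {n} {j} {j′} {c} pr p∤n j≤j′ j′<p p∣c+jn p∣c+j′n =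
  ≤-antisym j≤j′ (m∸n≡0⇒m≤n (<∧∣⇒≡0 (≤-<-trans (m∸n≤m j′ j) j′<p) p∣j′∸j))
  where
  distrib : ∀ c j d n → c + (j + d) * n ≡ c + j * n + d * n
  distrib = solve-∀
  split : c + j′ * n ≡ c + j * n + (j′ ∸ j) * n
  split = trans (cong (λ t → c + t * n) (sym (m+[n∸m]≡n j≤j′))) (distrib c j (j′ ∸ j) n)
  p∣j′∸j : p ∣ j′ ∸ j
  p∣j′∸j = [ id , (λ p∣n → contradiction p∣n p∤n) ]
             (euclidsLemma (j′ ∸ j) n pr (∣m+n∣m⇒∣n (subst (p ∣_) split p∣c+j′n) p∣c+jn))

progression-multiple-unique : Prime p → p ∤ n → j < p → j′ < p →
  p ∣ c + j * n → p ∣ c + j′ * n → j ≡ j′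
progression-multiple-unique {j = j} {j′ = j′} pr p∤n j<p j′<p p∣c+jn p∣c+j′n with ≤-total j j′
... | inj₁ j≤j′ = progression-multiple-unique-≤ pr p∤n j≤j′ j′<p p∣c+jn p∣c+j′n
... | inj₂ j′≤j = sym (progression-multiple-unique-≤ pr p∤n j′≤j j<p p∣c+j′n p∣c+jn)

∑𝟙[p∣c+j*n]≡1 : Prime p → p ∤ n → ∀ c → ∑[ j < p ] 𝟙 (p ∣? c + j * n) ≡ 1
∑𝟙[p∣c+j*n]≡1 {p} {n} pr p∤n c = ≤-antisym
  (∑𝟙≤1 (λ j → p ∣? c + j * n) p (progression-multiple-unique pr p∤n))
  (let j , j<p , p∣c+jn = ∃-progression-multiple pr p∤n c in
   subst (_≤ ∑[ j < p ] 𝟙 (p ∣? c + j * n)) (𝟙-yes p∣c+jn (p ∣? c + j * n)) (term≤∑ p j<p))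

Good⇔coprime : ∀ m n x → Good m n x ⇔ (∀ s → s < m → Coprime (x + s) n)
Good⇔coprime m n x = mk⇔ Good⇒coprime coprime⇒Good
  where
  Good⇒coprime : Good m n x → ∀ s → s < m → Coprime (x + s) n
  Good⇒coprime good s s<m = gcd≡1⇒coprime (applyUpTo⁻ id m good s<m)
  coprime⇒Good : (∀ s → s < m → Coprime (x + s) n) → Good m n x
  coprime⇒Good coprime = applyUpTo⁺₁ id m (λ {s} s<m → coprime⇒gcd≡1 (coprime s s<m))

Good-* : ∀ m a b x → Good m (a * b) x ⇔ (Good m a x × Good m b x)
Good-* m a b x = mk⇔
  (λ good → from (window a) (λ s s<m → coprime-∣ʳ (m∣m*n b) (to (window (a * b)) good s s<m))
          , from (window b) (λ s s<m → coprime-∣ʳ (n∣m*n a) (to (window (a * b)) good s s<m)))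
  (λ (good-a , good-b) → from (window (a * b)) (λ s s<m →
     coprime-*ʳ (to (window a) good-a s s<m) (to (window b) good-b s s<m)))
  where
  window : ∀ n → Good m n x ⇔ (∀ s → s < m → Coprime (x + s) n)
  window n = Good⇔coprime m n x

Good-∣ : ∀ m x → d ∣ n → Good m n x → Good m d x
Good-∣ {d} {n} m x d∣n good =
  from (Good⇔coprime m d x) (λ s s<m → coprime-∣ʳ d∣n (to (Good⇔coprime m n x) good s s<m))

Good-periodic : ∀ m n x j → Good m n (x + j * n) ⇔ Good m n x
Good-periodic m n x j = mk⇔
  (λ good → from (window x) (λ s s<m →
     to (coprime-+-*ˡ j)
        (subst (λ t → Coprime t n) (xy∙z≈xz∙y x (j * n) s) (to (window (x + j * n)) good s s<m))))
  (λ good → from (window (x + j * n)) (λ s s<m →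
     subst (λ t → Coprime t n) (xy∙z≈xz∙y x s (j * n)) (from (coprime-+-*ˡ j) (to (window x) good s s<m))))
  where
  window : ∀ x → Good m n x ⇔ (∀ s → s < m → Coprime (x + s) n)
  window x = Good⇔coprime m n x

Good-prime : ∀ m x → Prime p → Good m p x ⇔ (∀ s → s < m → p ∤ x + s)
Good-prime {p} m x pr = mk⇔
  (λ good s s<m → to (coprime-prime⇔∤ pr) (to (Good⇔coprime m p x) good s s<m))
  (λ p∤ → from (Good⇔coprime m p x) (λ s s<m → from (coprime-prime⇔∤ pr) (p∤ s s<m)))

¬Good-prime : ∀ x → Prime p → p < m → ¬ Good m p x
¬Good-prime {p} {m} x pr p<m good with ∃-progression-multiple pr (prime∤1 pr) x
... | s , s<p , p∣x+s*1 =
  to (Good-prime m x pr) good s (<-trans s<p p<m) (subst (λ t → p ∣ x + t) (*-identityʳ s) p∣x+s*1)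

𝟙good+∑𝟙[p∣x+s]≡1 : Prime p → m ≤ p → ∀ x → 𝟙 (good? m p x) + ∑[ s < m ] 𝟙 (p ∣? x + s) ≡ 1
𝟙good+∑𝟙[p∣x+s]≡1 {p} {m} pr m≤p x with good? m p x
... | yes good =
  cong suc (trans (∑-cong m (λ s s<m → 𝟙-no (to (Good-prime m x pr) good s s<m) (p ∣? x + s))) (∑-zero m))
... | no ¬good = ≤-antisym at-most-one (n≢0⇒n>0 at-least-one)
  where
  *1 : ∀ {s} → p ∣ x + s → p ∣ x + s * 1
  *1 {s} = subst (λ t → p ∣ x + t) (sym (*-identityʳ s))
  at-most-one : ∑[ s < m ] 𝟙 (p ∣? x + s) ≤ 1
  at-most-one = ∑𝟙≤1 (λ s → p ∣? x + s) m (λ s<m s′<m p∣x+s p∣x+s′ →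
    progression-multiple-unique pr (prime∤1 pr)
      (<-≤-trans s<m m≤p) (<-≤-trans s′<m m≤p) (*1 p∣x+s) (*1 p∣x+s′))
  at-least-one : ∑[ s < m ] 𝟙 (p ∣? x + s) ≢ 0
  at-least-one ∑≡0 =
    ¬good (from (Good-prime m x pr) (λ s s<m → 𝟙≡0⇒¬ (p ∣? x + s) (∑≡0⇒≡0 m ∑≡0 s s<m)))

∑𝟙good-progression : Prime p → p ∤ n → ∀ c → ∑[ j < p ] 𝟙 (good? m p (c + j * n)) ≡ p ∸ m
∑𝟙good-progression {p} {n} {m} pr p∤n c with m ≤? p
... | no m≰p = begin
  ∑[ j < p ] 𝟙 (good? m p (c + j * n))
    ≡⟨ ∑-cong p (λ j _ → 𝟙-no (¬Good-prime (c + j * n) pr p<m) (good? m p (c + j * n))) ⟩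
  ∑[ _ < p ] 0                         ≡⟨ ∑-zero p ⟩
  0                                    ≡⟨ sym (m≤n⇒m∸n≡0 (<⇒≤ p<m)) ⟩
  p ∸ m                                ∎
  where
  open ≡-Reasoning
  p<m : p < m
  p<m = ≰⇒> m≰p
-- Double counting: each window c + j n + [0, m) is Good or holds exactly one multiple of p,
-- and for each offset s < m exactly one j < p makes c + j n + s a multiple of p.
... | yes m≤p = trans (sym (m+n∸n≡m A m)) (cong (_∸ m) A+m≡p)
  where
  open ≡-Reasoning
  A : ℕ
  A = ∑[ j < p ] 𝟙 (good? m p (c + j * n))
  multiples : ℕ → ℕ
  multiples x = ∑[ s < m ] 𝟙 (p ∣? x + s)
  A+m≡p : A + m ≡ p
  A+m≡p = begin
    A + m
      ≡⟨ cong (A +_) (trans (sym (*-identityʳ m)) (sym (∑-const m 1))) ⟩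
    A + ∑[ _ < m ] 1
      ≡⟨ cong (A +_) (∑-cong m (λ s _ → sym (∑𝟙[p∣c+j*n]≡1 pr p∤n (c + s)))) ⟩
    A + ∑[ s < m ] ∑[ j < p ] 𝟙 (p ∣? c + s + j * n)
      ≡⟨ cong (A +_) (∑-cong m (λ s _ → ∑-cong p (λ j _ →
           cong (λ t → 𝟙 (p ∣? t)) (xy∙z≈xz∙y c s (j * n))))) ⟩
    A + ∑[ s < m ] ∑[ j < p ] 𝟙 (p ∣? c + j * n + s)
      ≡⟨ cong (A +_) (sym (∑-comm p m (λ j s → 𝟙 (p ∣? c + j * n + s)))) ⟩
    A + ∑[ j < p ] multiples (c + j * n)
      ≡⟨ sym (∑-+ p) ⟩
    ∑[ j < p ] (𝟙 (good? m p (c + j * n)) + multiples (c + j * n))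
      ≡⟨ ∑-cong p (λ j _ → 𝟙good+∑𝟙[p∣x+s]≡1 pr m≤p (c + j * n)) ⟩
    ∑[ _ < p ] 1
      ≡⟨ trans (∑-const p 1) (*-identityʳ p) ⟩
    p ∎

L≡∑ : ∀ m n → L m n ≡ ∑[ k < n ] 𝟙 (good? m n (suc k))
L≡∑ m n = length-filter-applyUpTo (λ k → good? m n (suc k)) id n

L[1]≡1 : ∀ m → L m 1 ≡ 1
L[1]≡1 m = trans (L≡∑ m 1)
  (𝟙-yes (from (Good⇔coprime m 1 1) (λ _ _ (_ , d∣1) → ∣1⇒≡1 d∣1)) (good? m 1 1))

𝟙good-* : ∀ m a b x → 𝟙 (good? m (a * b) x) ≡ 𝟙 (good? m a x) * 𝟙 (good? m b x)
𝟙good-* m a b x = 𝟙-× (Good-* m a b x) (good? m (a * b) x) (good? m a x) (good? m b x)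

𝟙good-periodic : ∀ m n j i → 𝟙 (good? m n (suc (j * n + i))) ≡ 𝟙 (good? m n (suc i))
𝟙good-periodic m n j i = trans (cong (λ t → 𝟙 (good? m n (suc t))) (+-comm (j * n) i))
  (𝟙-cong (Good-periodic m n (suc i) j) (good? m n (suc i + j * n)) (good? m n (suc i)))

L-*-∣ : p ∣ n → L m (p * n) ≡ p * L m n
L-*-∣ {p} {n} {m} p∣n = begin
  L m (p * n)                                 ≡⟨ L≡∑ m (p * n) ⟩
  ∑[ k < p * n ] 𝟙 (good? m (p * n) (suc k)) ≡⟨ ∑-cong (p * n) (λ k _ → 𝟙-p*n≡𝟙-n (suc k)) ⟩
  ∑[ k < p * n ] 𝟙 (good? m n (suc k))       ≡⟨ ∑-periodic p n (𝟙good-periodic m n) ⟩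
  p * ∑[ k < n ] 𝟙 (good? m n (suc k))       ≡⟨ cong (p *_) (sym (L≡∑ m n)) ⟩
  p * L m n                                   ∎
  where
  open ≡-Reasoning
  Good-p*n⇔Good-n : ∀ x → Good m (p * n) x ⇔ Good m n x
  Good-p*n⇔Good-n x = mk⇔ (proj₂ ∘ to (Good-* m p n x))
    (λ good → from (Good-* m p n x) (Good-∣ m x p∣n good , good))
  𝟙-p*n≡𝟙-n : ∀ x → 𝟙 (good? m (p * n) x) ≡ 𝟙 (good? m n x)
  𝟙-p*n≡𝟙-n x = 𝟙-cong (Good-p*n⇔Good-n x) (good? m (p * n) x) (good? m n x)

L-*-prime-∤ : Prime p → p ∤ n → L m (p * n) ≡ (p ∸ m) * L m n
L-*-prime-∤ {p} {n} {m} pr p∤n = begin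
  L m (p * n)
    ≡⟨ L≡∑ m (p * n) ⟩
  ∑[ k < p * n ] 𝟙 (good? m (p * n) (suc k))
    ≡⟨ ∑-cong (p * n) (λ k _ → 𝟙good-* m p n (suc k)) ⟩
  ∑[ k < p * n ] (𝟙 (good? m p (suc k)) * 𝟙 (good? m n (suc k)))
    ≡⟨ ∑-blocks p n ⟩
  ∑[ j < p ] ∑[ i < n ] (𝟙 (good? m p (suc (j * n + i))) * 𝟙 (good? m n (suc (j * n + i))))
    ≡⟨ ∑-cong p (λ j _ → ∑-cong n (λ i _ → cong₂ _*_
         (cong (λ t → 𝟙 (good? m p (suc t))) (+-comm (j * n) i)) (𝟙good-periodic m n j i))) ⟩
  ∑[ j < p ] ∑[ i < n ] (𝟙 (good? m p (suc i + j * n)) * χ i)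
    ≡⟨ ∑-comm p n _ ⟩
  ∑[ i < n ] ∑[ j < p ] (𝟙 (good? m p (suc i + j * n)) * χ i)
    ≡⟨ ∑-cong n (λ i _ → ∑-*ʳ p (χ i)) ⟩
  ∑[ i < n ] (∑[ j < p ] 𝟙 (good? m p (suc i + j * n)) * χ i)
    ≡⟨ ∑-cong n (λ i _ → cong (_* χ i) (∑𝟙good-progression pr p∤n (suc i))) ⟩
  ∑[ i < n ] ((p ∸ m) * χ i)
    ≡⟨ ∑-*ˡ n (p ∸ m) ⟩
  (p ∸ m) * ∑[ i < n ] χ i
    ≡⟨ cong ((p ∸ m) *_) (sym (L≡∑ m n)) ⟩
  (p ∸ m) * L m n ∎
  where
  open ≡-Reasoning
  χ : ℕ → ℕ
  χ i = 𝟙 (good? m n (suc i))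

L-prime : Prime p → L m p ≡ p ∸ m
L-prime {p} {m} pr = begin
  L m p           ≡⟨ cong (L m) (sym (*-identityʳ p)) ⟩
  L m (p * 1)     ≡⟨ L-*-prime-∤ pr (prime∤1 pr) ⟩
  (p ∸ m) * L m 1 ≡⟨ cong ((p ∸ m) *_) (L[1]≡1 m) ⟩
  (p ∸ m) * 1     ≡⟨ *-identityʳ (p ∸ m) ⟩
  p ∸ m           ∎
  where open ≡-Reasoning

L-*-prime : Prime p → ∀ n → L m (p * n) ≡ p * L m n ⊎ L m (p * n) ≡ L m p * L m n
L-*-prime {p} {m} pr n with p ∣? n
... | yes p∣n = inj₁ (L-*-∣ p∣n)
... | no p∤n  = inj₂ (trans (L-*-prime-∤ pr p∤n) (cong (_* L m n) (sym (L-prime pr))))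

prime-factorisation-induction : (A : ℕ → Set) → A 1 → (∀ {p n} → Prime p → A n → A (p * n)) →
  ∀ n → .{{NonZero n}} → A n
prime-factorisation-induction A A[1] step n = subst A (sym isFactorisation) (over-primes factorsPrime)
  where
  open PrimeFactorisation (factorise n)
  over-primes : ∀ {ps} → All Prime ps → A (product ps)
  over-primes []         = A[1]
  over-primes (pr ∷ prs) = step pr (over-primes prs)

L-mono-∣ : d ∣ n → L m d ∣ L m n
L-mono-∣ {d} {m = m} (divides zero refl) = L m d ∣0
L-mono-∣ {d} {m = m} (divides q@(suc _) refl) =
  prime-factorisation-induction (λ q → L m d ∣ L m (q * d)) base step q
  where
  base : L m d ∣ L m (1 * d)
  base = ∣-reflexive (cong (L m) (sym (*-identityˡ d)))
  step : ∀ {p q} → Prime p → L m d ∣ L m (q * d) → L m d ∣ L m (p * q * d)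
  step {p} {q} pr L[d]∣ = subst (λ t → L m d ∣ L m t) (sym (*-assoc p q d))
    (∣-trans L[d]∣ ([ divides p , divides (L m p) ] (L-*-prime pr (q * d))))

ReachesZero : ℕ → ℕ → Set
ReachesZero m n = ∃[ k ] iter (L m) k n ≡ 0

iter-suc : ∀ k n → iter f (suc k) n ≡ iter f k (f n)
iter-suc zero    n = refl
iter-suc {f} (suc k) n = cong f (iter-suc k n)

iter-L-mono-∣ : d ∣ n → ∀ k → iter (L m) k d ∣ iter (L m) k n
iter-L-mono-∣ d∣n zero    = d∣n
iter-L-mono-∣ d∣n (suc k) = L-mono-∣ (iter-L-mono-∣ d∣n k)

ReachesZero-∣ : d ∣ n → ReachesZero m d → ReachesZero m n
ReachesZero-∣ d∣n (k , e) = k , 0∣⇒≡0 (subst (_∣ _) e (iter-L-mono-∣ d∣n k))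

¬ReachesZero-L : ¬ ReachesZero m n → ¬ ReachesZero m (L m n)
¬ReachesZero-L {m} {n} ¬zero (k , e) = ¬zero (suc k , trans (iter-suc k n) e)

Survives : ℕ → ℕ → Set
Survives m n = n ≢ 0 × (∀ p → Prime p → p ∣ n → ¬ ReachesZero m p)

¬ReachesZero⇒Survives : ¬ ReachesZero m n → Survives m n
¬ReachesZero⇒Survives ¬zero =
  (λ n≡0 → ¬zero (0 , n≡0)) , (λ _ _ p∣n zero-p → ¬zero (ReachesZero-∣ p∣n zero-p))

Survives-∣ : d ∣ n → Survives m n → Survives m d
Survives-∣ d∣n (n≢0 , h) =
  (λ d≡0 → n≢0 (0∣⇒≡0 (subst (_∣ _) d≡0 d∣n))) , (λ p pr p∣d → h p pr (∣-trans p∣d d∣n))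

Survives-* : Survives m a → Survives m b → Survives m (a * b)
Survives-* {a = a} {b} (a≢0 , ha) (b≢0 , hb) =
    (λ ab≡0 → [ a≢0 , b≢0 ] (m*n≡0⇒m≡0∨n≡0 a ab≡0))
  , (λ p pr p∣ab → [ ha p pr , hb p pr ] (euclidsLemma a b pr p∣ab))

Survives-L : Survives m n → Survives m (L m n)
Survives-L {m} {n} s@(n≢0 , _) =
  prime-factorisation-induction (λ n → Survives m n → Survives m (L m n))
    (subst (Survives m) (sym (L[1]≡1 m))) step n {{≢-nonZero n≢0}} s
  where
  step : ∀ {p n} → Prime p → (Survives m n → Survives m (L m n)) →
         Survives m (p * n) → Survives m (L m (p * n))
  step {p} {n} pr ih s@(_ , h) =
    [ (λ e → times-L[n] e (¬ReachesZero⇒Survives p-survives))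
    , (λ e → times-L[n] e (¬ReachesZero⇒Survives (¬ReachesZero-L p-survives))) ]
    (L-*-prime pr n)
    where
    p-survives : ¬ ReachesZero m p
    p-survives = h p pr (m∣m*n n)
    times-L[n] : L m (p * n) ≡ c * L m n → Survives m c → Survives m (L m (p * n))
    times-L[n] e survives-c = subst (Survives m) (sym e) (Survives-* survives-c (ih (Survives-∣ (n∣m*n p) s)))

Survives⇒iter≢0 : Survives m n → ∀ k → iter (L m) k n ≢ 0
Survives⇒iter≢0         s zero    = proj₁ s
Survives⇒iter≢0 {m} {n} s (suc k) = Survives⇒iter≢0 (Survives-L s) k ∘ trans (sym (iter-suc k n))

Survives⇒¬ReachesZero : Survives m n → ¬ ReachesZero m n
Survives⇒¬ReachesZero s (k , e) = Survives⇒iter≢0 s k e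

¬ReachesZero-* : ¬ ReachesZero m a → ¬ ReachesZero m b → ¬ ReachesZero m (a * b)
¬ReachesZero-* ¬zero-a ¬zero-b =
  Survives⇒¬ReachesZero (Survives-* (¬ReachesZero⇒Survives ¬zero-a) (¬ReachesZero⇒Survives ¬zero-b))

iter-L-from-1 : ∀ {k} → iter (L m) k n ≡ 1 → ∀ d → iter (L m) (d + k) n ≡ 1
iter-L-from-1     e zero    = e
iter-L-from-1 {m} e (suc d) = trans (cong (L m) (iter-L-from-1 e d)) (L[1]≡1 m)

IsH-cases : ∀ {h} → n ≢ 0 → IsH m n h → (h ≡ 0 × ReachesZero m n) ⊎ (h ≡ 1 × ¬ ReachesZero m n)
IsH-cases n≢0 (k , (_ , inj₁ iter≡0 , _) , refl) = inj₁ (iter≡0 , k , iter≡0)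
IsH-cases {n} {m} n≢0 (k , (_ , inj₂ iter≡1 , minimal) , refl) = inj₂ (iter≡1 , never-zero)
  where
  never-zero : ¬ ReachesZero m n
  never-zero (zero , e) = n≢0 e
  never-zero (suc j , e) with suc j <? k
  ... | yes j<k = minimal (suc j) (s≤s z≤n) j<k (inj₁ e)
  ... | no  j≮k = 1+n≢0 (trans (sym (iter-L-from-1 iter≡1 (suc j ∸ k)))
                               (trans (cong (λ t → iter (L m) t n) (m∸n+n≡m (≮⇒≥ j≮k))) e))

theorem1p3 : (m x y hx hy hxy : ℕ) → 1 ≤ m → 1 ≤ x → 1 ≤ y →
    IsH m x hx → IsH m y hy → IsH m (x * y) hxy → hxy ≡ hx * hy
theorem1p3 m x y hx hy hxy _ 1≤x 1≤y Hx Hy Hxy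
  with IsH-cases (m<n⇒n≢0 1≤x) Hx
     | IsH-cases (m<n⇒n≢0 1≤y) Hy
     | IsH-cases (m<n⇒n≢0 (*-mono-≤ 1≤x 1≤y)) Hxy
... | inj₁ (refl , _)    | _                  | inj₁ (refl , _)     = refl
... | inj₂ (refl , _)    | inj₁ (refl , _)    | inj₁ (refl , _)     = refl
... | inj₂ (refl , _)    | inj₂ (refl , _)    | inj₂ (refl , _)     = refl
... | inj₂ (_ , ¬zero-x) | inj₂ (_ , ¬zero-y) | inj₁ (_ , zero-xy)  =
  contradiction zero-xy (¬ReachesZero-* ¬zero-x ¬zero-y)
... | inj₁ (_ , zero-x)  | _                  | inj₂ (_ , ¬zero-xy) =
  contradiction (ReachesZero-∣ (m∣m*n y) zero-x) ¬zero-xy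
... | inj₂ _             | inj₁ (_ , zero-y)  | inj₂ (_ , ¬zero-xy) =
  contradiction (ReachesZero-∣ (n∣m*n x) zero-y) ¬zero-xy
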